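{- If $\pi\in\mathcal{C}_{1,1}\cap\mathrm{Av}(3142)$ has a spiral decomposition with $m$ blocks, then the treewidth of $G_\pi$ is at most $6m$.
   Context: $\mathcal{C}_{1,1}$ is the set of permutations partitionable into one increasing and one decreasing subsequence; $\mathrm{Av}(3142)$ is the set of permutations avoiding the pattern $3142$. For a permutation $\pi=\pi(1),\dots,\pi(n)$, $G_\pi$ has vertex set $\{1,\dots,n\}$ (values of $\pi$), with $\pi(i),\pi(j)$ adjacent iff $|i-j|=1$ or $|\pi(i)-\pi(j)|=1$. Element $x$ is above $y$ if $x>y$, left of $y$ if it occurs earlier; for sets the relation holds for all pairs. A spiral decomposition of $\pi$ is a partition of its elements into possibly empty blocks $B_1,\dots,B_m$ such that (a) $B_i$ is decreasing for odd $i$ and increasing for even $i$; (b) with $B_{>i}=\bigcup_{j>i}B_j$ and $r_i$ the remainder of $i$ mod 4: if $r_i=0$, $B_i$ is above $B_{i-1}$ and $B_{>i}$ is above and left of $B_{i-1}$; if $r_i=1$ and $i>1$, $B_i$ is left of $B_{i-1}$ and $B_{>i}$ is below and left of $B_{i-1}$; if $r_i=2$, $B_i$ is below $B_{i-1}$ and $B_{>i}$ is below and right of $B_{i-1}$; if $r_i=3$, $B_i$ is right of $B_{i-1}$ and $B_{>i}$ is above and right of $B_{i-1}$. -}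

module Defs where

open import Data.Nat using (ℕ; zero; suc; _+_; _*_; _≤_; _<_; _>_)
open import Data.Nat.DivMod using (_%_)
open import Data.Fin using (Fin; toℕ; suc)
open import Data.Fin.Subset using (Subset; _∈_; ∣_∣)
open import Data.Fin.Permutation using (Permutation′; _⟨$⟩ʳ_; _⟨$⟩ˡ_)
open import Data.Product using (Σ; ∃; _×_)
open import Data.Sum using (_⊎_)
open import Data.Bool using (Bool; true; false)
open import Relation.Binary.PropositionalEquality using (_≡_)
open import Relation.Nullary using (¬_)

-- An "element" of π is identified with its position i : Fin n
-- (its value is π ⟨$⟩ʳ i).  Values and positions are 0-based here,
-- which does not affect any order comparison.

AbsDiffOne : ℕ → ℕ → Set
AbsDiffOne a b = a ≡ suc b ⊎ b ≡ suc a

InC11 : ∀ {n} → Permutation′ n → Set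
InC11 {n} π = Σ (Fin n → Bool) λ c →
  (∀ i j → c i ≡ true → c j ≡ true → toℕ i < toℕ j →
     toℕ (π ⟨$⟩ʳ i) < toℕ (π ⟨$⟩ʳ j)) ×
  (∀ i j → c i ≡ false → c j ≡ false → toℕ i < toℕ j →
     toℕ (π ⟨$⟩ʳ i) > toℕ (π ⟨$⟩ʳ j))

Contains3142 : ∀ {n} → Permutation′ n → Set
Contains3142 {n} π = Σ (Fin n) λ i → Σ (Fin n) λ j → Σ (Fin n) λ k → Σ (Fin n) λ l →
  (toℕ i < toℕ j) × (toℕ j < toℕ k) × (toℕ k < toℕ l) ×
  (toℕ (π ⟨$⟩ʳ j) < toℕ (π ⟨$⟩ʳ l)) ×
  (toℕ (π ⟨$⟩ʳ l) < toℕ (π ⟨$⟩ʳ i)) ×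
  (toℕ (π ⟨$⟩ʳ i) < toℕ (π ⟨$⟩ʳ k))

Avoids3142 : ∀ {n} → Permutation′ n → Set
Avoids3142 π = ¬ Contains3142 π

Graph : ℕ → Set₁
Graph n = Fin n → Fin n → Set

-- G_π: vertices are the values of π; values a, b adjacent iff their
-- positions differ by 1 or the values differ by 1.
Gπ : ∀ {n} → Permutation′ n → Graph n
Gπ π a b = AbsDiffOne (toℕ (π ⟨$⟩ˡ a)) (toℕ (π ⟨$⟩ˡ b)) ⊎ AbsDiffOne (toℕ a) (toℕ b)

-- Trees: every finite tree with k+1 nodes can be labelled 0..k so that
-- each node j+1 has a parent with smaller label (root = 0).

record Tree : Set where
  field
    size   : ℕ                       -- the tree has suc size nodes
    parent : Fin size → Fin (suc size)   -- parent of node (suc j)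
    parent< : ∀ j → toℕ (parent j) ≤ toℕ j

open Tree public

Node : Tree → Set
Node T = Fin (suc (size T))

TAdj : (T : Tree) → Node T → Node T → Set
TAdj T a b = (Σ (Fin (size T)) λ j → (a ≡ suc j) × (b ≡ parent T j))
           ⊎ (Σ (Fin (size T)) λ j → (b ≡ suc j) × (a ≡ parent T j))

data WalkIn (T : Tree) (S : Node T → Set) : Node T → Node T → Set where
  here : ∀ {a} → S a → WalkIn T S a a
  step : ∀ {a b c} → S a → TAdj T a b → WalkIn T S b c → WalkIn T S a c

ConnectedIn : (T : Tree) → (Node T → Set) → Set
ConnectedIn T S = ∀ a b → S a → S b → WalkIn T S a b

record TreeDecomposition {n} (G : Graph n) : Set₁ where
  field
    tree : Tree
    bag  : Node tree → Subset n
    covers-vertices : ∀ v → Σ (Node tree) λ x → v ∈ bag x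
    covers-edges    : ∀ u v → G u v → Σ (Node tree) λ x → (u ∈ bag x) × (v ∈ bag x)
    connected       : ∀ v → ConnectedIn tree (λ x → v ∈ bag x)

open TreeDecomposition public

WidthAtMost : ∀ {n} {G : Graph n} → TreeDecomposition G → ℕ → Set
WidthAtMost D w = ∀ x → ∣ bag D x ∣ ≤ suc w

TreewidthAtMost : ∀ {n} → Graph n → ℕ → Set₁
TreewidthAtMost G w = Σ (TreeDecomposition G) λ D → WidthAtMost D w

-- Spiral decompositions with m blocks B_1..B_m (possibly empty).
-- blk i ∈ {1..m} is the index of the block containing element (position) i.

-- relation required between x ∈ B_j (or B_{>j}) and y ∈ B_{j-1}
-- according to r = j mod 4.
BlockRel : ℕ → (px vx py vy : ℕ) → Set
BlockRel r px vx py vy with r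
... | 0 = vx > vy
... | 1 = px < py
... | 2 = vx < vy
... | _ = px > py

RestRel : ℕ → (px vx py vy : ℕ) → Set       -- x ∈ B_{>j}, y ∈ B_{j-1}
RestRel r px vx py vy with r
... | 0 = (vx > vy) × (px < py)
... | 1 = (vx < vy) × (px < py)
... | 2 = (vx < vy) × (px > py)
... | _ = (vx > vy) × (px > py)

record SpiralDecomposition {n} (π : Permutation′ n) (m : ℕ) : Set where
  pos : Fin n → ℕ
  pos i = toℕ i
  val : Fin n → ℕ
  val i = toℕ (π ⟨$⟩ʳ i)
  field
    blk      : Fin n → ℕ
    blk-range : ∀ i → (1 ≤ blk i) × (blk i ≤ m)
    odd-dec  : ∀ i j → blk i ≡ blk j → blk i % 2 ≡ 1 → pos i < pos j → val i > val j
    even-inc : ∀ i j → blk i ≡ blk j → blk i % 2 ≡ 0 → pos i < pos j → val i < val j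
    -- (b) for every block index j = k+1 with 2 ≤ j ≤ m (k = blk y ≥ 1):
    block-cond : ∀ x y → blk x ≡ suc (blk y) →
      BlockRel (blk x % 4) (pos x) (val x) (pos y) (val y)
    rest-cond  : ∀ x y (k : ℕ) → suc (blk y) ≡ k → k < blk x → k ≤ m →
      RestRel (k % 4) (pos x) (val x) (pos y) (val y)

-- Order the elements of π by a key and take the path decomposition whose bag at time t holds
-- the vertices v with key v ≤ t that have a closed neighbour w with t ≤ key w.  The key merges
-- the blocks of the spiral one at a time: B_(k+1) is interleaved with B_k according to axis k,
-- the coordinate in which B_k lies below B_(k-1), so that on B_k ∪ B_(k+1) the key increases
-- with axis k.  Since the other blocks lie on one side of B_k in both coordinates, an element
-- strictly between two elements a, b of one block, in position or in value, has a smaller key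
-- than a or than b.  Hence each block contributes to the bag at time t at most one element of
-- key t and, for each of the four relations "position ± 1" and "value ± 1", at most one element
-- of key < t with a neighbour of key ≥ t in that relation: bags have at most 5m elements.
module Submission where

open import Defs
open import Data.Nat using (ℕ; _*_)
open import Data.Fin.Permutation using (Permutation′)

open import Data.Nat using (zero; suc; _+_; _∸_; _^_; _≤_; _<_; _⊔_; _≟_; _<?_; _≤?_; z≤n; s≤s)
open import Data.Nat.Properties
open import Data.Nat.DivMod using (_%_)
open import Data.Fin using (Fin; toℕ; fromℕ<; inject₁) renaming (zero to fzero; suc to fsuc)
open import Data.Fin.Properties using (toℕ-fromℕ<; toℕ-inject₁; toℕ-injective; toℕ<n; any?)
  renaming (_≟_ to _≟ᶠ_)
open import Data.Fin.Subset using (Subset; _∈_; ∣_∣; _∪_; ⁅_⁆; inside; outside) renaming (⊥ to ∅)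
open import Data.Fin.Subset.Properties using (p⊆q⇒∣p∣≤∣q∣; x∈p∪q⁺; x∈⁅x⁆; ∣⁅x⁆∣≡1; ∣⊥∣≡0)
open import Data.Fin.Permutation using (_⟨$⟩ʳ_; _⟨$⟩ˡ_; inverseˡ; inverseʳ)
open import Data.Vec using (tabulate; _∷_; [])
open import Data.Vec.Properties using (lookup∘tabulate; []=⇒lookup; lookup⇒[]=)
open import Data.List using (List; []; _∷_; _++_; length; map; concatMap; upTo)
open import Data.List.Properties using (length-map; length-++; length-upTo)
open import Data.List.Membership.Propositional using () renaming (_∈_ to _∈ᴸ_)
open import Data.List.Membership.Propositional.Properties using (∈-map⁺; ∈-concat⁺′; ∈-upTo⁺)
open import Data.List.Relation.Unary.Any using (here; there)
open import Data.Product using (Σ; ∃-syntax; _×_; _,_; proj₁; proj₂)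
open import Data.Sum using (_⊎_; inj₁; inj₂; [_,_]′; swap) renaming (map to ⊎-map)
open import Data.Bool using (true)
open import Data.Empty using (⊥; ⊥-elim)
open import Function using (_∘_)
open import Relation.Binary.PropositionalEquality
  using (_≡_; _≢_; refl; sym; trans; cong; subst; subst₂)
open import Relation.Binary.Definitions using (tri<; tri≈; tri>)
open import Relation.Nullary using (Dec; yes; no; does; ¬_)
open import Relation.Nullary.Decidable using (dec-true; _×-dec_; _⊎-dec_)

maxOver : ∀ {k} → (Fin k → ℕ) → ℕ
maxOver {zero}  f = 0
maxOver {suc k} f = f fzero ⊔ maxOver (f ∘ fsuc)

≤maxOver : ∀ {k} (f : Fin k → ℕ) i → f i ≤ maxOver f
≤maxOver f fzero    = m≤m⊔n _ _
≤maxOver f (fsuc i) = ≤-trans (≤maxOver (f ∘ fsuc) i) (m≤n⊔m _ _)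

maxOver-mono : ∀ {k} {f g : Fin k → ℕ} → (∀ i → f i ≤ g i) → maxOver f ≤ maxOver g
maxOver-mono {zero}  f≤g = z≤n
maxOver-mono {suc k} f≤g = ⊔-mono-≤ (f≤g fzero) (maxOver-mono (f≤g ∘ fsuc))

maxOver< : ∀ {k} {f : Fin k → ℕ} {v} → 0 < v → (∀ i → f i < v) → maxOver f < v
maxOver< {zero}  0<v f<v = 0<v
maxOver< {suc k} 0<v f<v = ⊔-lub (f<v fzero) (maxOver< 0<v (f<v ∘ fsuc))

data Relative (j i : ℕ) : Set where
  same     : j ≡ i → Relative j i
  next     : j ≡ suc i → Relative j i
  later    : suc i < j → Relative j i
  previous : suc j ≡ i → Relative j i
  earlier  : suc j < i → Relative j i

relative : ∀ j i → Relative j i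
relative j i with <-cmp j i
... | tri≈ _ j≡i _ = same j≡i
... | tri> _ _ i<j = [ later , next ∘ sym ]′ (m≤n⇒m<n∨m≡n i<j)
... | tri< j<i _ _ = [ earlier , previous ]′ (m≤n⇒m<n∨m≡n j<i)

digits< : ∀ {a b d d′} N → a ≤ b → d < d′ → a * N + d < b * N + d′
digits< N a≤b d<d′ = +-mono-≤-< (*-monoˡ-≤ N a≤b) d<d′

carry< : ∀ {a b d} N → a < b → d < N → a * N + d < b * N
carry< {a} {b} {d} N a<b d<N = begin-strict
  a * N + d  <⟨ +-monoʳ-< (a * N) d<N ⟩
  a * N + N  ≡⟨ +-comm (a * N) N ⟩
  suc a * N  ≤⟨ *-monoˡ-≤ N a<b ⟩
  b * N      ∎
  where open ≤-Reasoning

Between : ℕ → ℕ → ℕ → Set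
Between a w b = (a < w × w < b) ⊎ (b < w × w < a)

between-reverse : ∀ {n a w b} → a ≤ n → w ≤ n → b ≤ n →
                  Between a w b → Between (n ∸ a) (n ∸ w) (n ∸ b)
between-reverse a≤n w≤n b≤n (inj₁ (a<w , w<b)) = inj₂ (∸-monoʳ-< w<b b≤n , ∸-monoʳ-< a<w w≤n)
between-reverse a≤n w≤n b≤n (inj₂ (b<w , w<a)) = inj₁ (∸-monoʳ-< w<a a≤n , ∸-monoʳ-< b<w w≤n)

below-both⇒¬Between : ∀ {a w b} → w < a → w < b → ¬ Between a w b
below-both⇒¬Between w<a w<b (inj₁ (a<w , _)) = <-asym a<w w<a
below-both⇒¬Between w<a w<b (inj₂ (b<w , _)) = <-asym b<w w<b

above-both⇒¬Between : ∀ {a w b} → a < w → b < w → ¬ Between a w b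
above-both⇒¬Between a<w b<w (inj₁ (_ , w<b)) = <-asym w<b b<w
above-both⇒¬Between a<w b<w (inj₂ (_ , w<a)) = <-asym w<a a<w

AtMostOne : ∀ {A : Set} → (A → Set) → Set
AtMostOne P = ∀ {x y} → P x → P y → x ≡ y

module _ {A : Set} (f : A → ℕ) (f-injective : ∀ {x y} → f x ≡ f y → x ≡ y) where

  reflect-< : ∀ (g : A → ℕ) {x y} → (f y < f x → g y < g x) → g x < g y → f x < f y
  reflect-< g {x} {y} mono gx<gy with <-cmp (f x) (f y)
  ... | tri< fx<fy _ _ = fx<fy
  ... | tri≈ _ fx≡fy _ = ⊥-elim (<-irrefl (cong g (f-injective fx≡fy)) gx<gy)
  ... | tri> _ _ fy<fx = ⊥-elim (<-asym gx<gy (mono fy<fx))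

  atMostOne-by : ∀ {P : A → Set} → (∀ {x y} → P x → P y → f x < f y → ⊥) → AtMostOne P
  atMostOne-by ordered {x} {y} px py with <-cmp (f x) (f y)
  ... | tri< fx<fy _ _ = ⊥-elim (ordered px py fx<fy)
  ... | tri≈ _ fx≡fy _ = f-injective fx≡fy
  ... | tri> _ _ fy<fx = ⊥-elim (ordered py px fy<fx)

witness : ∀ {k} {P : Fin k → Set} → (∀ x → Dec (P x)) → List (Fin k)
witness P? with any? P?
... | yes (x , _) = x ∷ []
... | no _        = []

length-witness≤1 : ∀ {k} {P : Fin k → Set} (P? : ∀ x → Dec (P x)) → length (witness P?) ≤ 1
length-witness≤1 P? with any? P?
... | yes _ = ≤-refl
... | no _  = z≤n

∈-witness : ∀ {k} {P : Fin k → Set} (P? : ∀ x → Dec (P x)) → AtMostOne P →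
            ∀ {x} → P x → x ∈ᴸ witness P?
∈-witness P? unique {x} px with any? P?
... | yes (y , py) = here (unique px py)
... | no ∄P        = ⊥-elim (∄P (x , px))

module _ {A B : Set} (f : A → List B) where

  length-concatMap≤ : ∀ {k} → (∀ x → length (f x) ≤ k) →
                      ∀ xs → length (concatMap f xs) ≤ k * length xs
  length-concatMap≤ {k} short []       = z≤n
  length-concatMap≤ {k} short (x ∷ xs) = begin
    length (f x ++ concatMap f xs)            ≡⟨ length-++ (f x) ⟩
    length (f x) + length (concatMap f xs)    ≤⟨ +-mono-≤ (short x) (length-concatMap≤ short xs) ⟩
    k + k * length xs                         ≡⟨ *-suc k (length xs) ⟨
    k * suc (length xs)                       ∎
    where open ≤-Reasoning

  ∈-concatMap⁺′ : ∀ {x xs y} → y ∈ᴸ f x → x ∈ᴸ xs → y ∈ᴸ concatMap f xs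
  ∈-concatMap⁺′ y∈fx x∈xs = ∈-concat⁺′ y∈fx (∈-map⁺ f x∈xs)

fromDec : ∀ {k} {P : Fin k → Set} → (∀ v → Dec (P v)) → Subset k
fromDec P? = tabulate (λ v → does (P? v))

∈fromDec⁺ : ∀ {k} {P : Fin k → Set} (P? : ∀ v → Dec (P v)) {v} → P v → v ∈ fromDec P?
∈fromDec⁺ P? {v} pv = lookup⇒[]= v _ (trans (lookup∘tabulate _ v) (dec-true (P? v) pv))

∈fromDec⁻ : ∀ {k} {P : Fin k → Set} (P? : ∀ v → Dec (P v)) {v} → v ∈ fromDec P? → P v
∈fromDec⁻ P? {v} v∈ = yes⇒ (P? v) (trans (sym (lookup∘tabulate _ v)) ([]=⇒lookup v∈))
  where
    yes⇒ : ∀ {A : Set} (a? : Dec A) → does a? ≡ true → A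
    yes⇒ (yes a) _ = a

∣p∪q∣≤∣p∣+∣q∣ : ∀ {k} (p q : Subset k) → ∣ p ∪ q ∣ ≤ ∣ p ∣ + ∣ q ∣
∣p∪q∣≤∣p∣+∣q∣ []            []            = z≤n
∣p∪q∣≤∣p∣+∣q∣ (outside ∷ p) (outside ∷ q) = ∣p∪q∣≤∣p∣+∣q∣ p q
∣p∪q∣≤∣p∣+∣q∣ (outside ∷ p) (inside ∷ q)  =
  ≤-trans (s≤s (∣p∪q∣≤∣p∣+∣q∣ p q)) (≤-reflexive (sym (+-suc _ _)))
∣p∪q∣≤∣p∣+∣q∣ (inside ∷ p)  (outside ∷ q) = s≤s (∣p∪q∣≤∣p∣+∣q∣ p q)
∣p∪q∣≤∣p∣+∣q∣ (inside ∷ p)  (inside ∷ q)  =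
  s≤s (≤-trans (∣p∪q∣≤∣p∣+∣q∣ p q) (≤-trans (n≤1+n _) (≤-reflexive (sym (+-suc _ _)))))

fromList : ∀ {k} → List (Fin k) → Subset k
fromList []       = ∅
fromList (x ∷ xs) = ⁅ x ⁆ ∪ fromList xs

∣fromList∣≤length : ∀ {k} (xs : List (Fin k)) → ∣ fromList xs ∣ ≤ length xs
∣fromList∣≤length {k} []       = ≤-reflexive (∣⊥∣≡0 k)
∣fromList∣≤length (x ∷ xs) = begin
  ∣ ⁅ x ⁆ ∪ fromList xs ∣         ≤⟨ ∣p∪q∣≤∣p∣+∣q∣ ⁅ x ⁆ (fromList xs) ⟩
  ∣ ⁅ x ⁆ ∣ + ∣ fromList xs ∣     ≡⟨ cong (_+ ∣ fromList xs ∣) (∣⁅x⁆∣≡1 x) ⟩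
  suc ∣ fromList xs ∣             ≤⟨ s≤s (∣fromList∣≤length xs) ⟩
  suc (length xs)                 ∎
  where open ≤-Reasoning

∈fromList : ∀ {k} {x : Fin k} (xs : List (Fin k)) → x ∈ᴸ xs → x ∈ fromList xs
∈fromList (y ∷ xs) (here refl) = x∈p∪q⁺ (inj₁ (x∈⁅x⁆ y))
∈fromList (y ∷ xs) (there x∈) = x∈p∪q⁺ (inj₂ (∈fromList xs x∈))

module _ {T : Tree} {P : Node T → Set} where

  snoc : ∀ {a b c} → WalkIn T P a b → TAdj T b c → P c → WalkIn T P a c
  snoc (here pa)          b~c pc = step pa b~c (here pc)
  snoc (step pa a~a′ a′⇝b) b~c pc = step pa a~a′ (snoc a′⇝b b~c pc)

  reverse : ∀ {a b} → WalkIn T P a b → WalkIn T P b a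
  reverse (here pa)          = here pa
  reverse (step pa a~a′ a′⇝b) = snoc (reverse a′⇝b) (swap a~a′) pa

module PathTree (S : ℕ) where

  path : Tree
  path = record { size = S ; parent = inject₁ ; parent< = λ j → ≤-reflexive (toℕ-inject₁ j) }

  Interval : (Node path → Set) → Node path → Node path → Set
  Interval P a b = ∀ t → toℕ a ≤ toℕ t → toℕ t ≤ toℕ b → P t

  walk-up : ∀ {P} d {a b} → d + toℕ a ≡ toℕ b → Interval P a b → WalkIn path P a b
  walk-up zero    {a} a≡b a⋯b =
    subst (WalkIn path _ a) (toℕ-injective a≡b) (here (a⋯b a ≤-refl (≤-reflexive a≡b)))
  walk-up (suc d) {a} {b} eq a⋯b =
    step (a⋯b a ≤-refl (≤-trans (m≤n+m _ (suc d)) (≤-reflexive eq))) a~a⁺ (walk-up d eq⁺ a⁺⋯b)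
    where
      a<S : toℕ a < S
      a<S = ≤-trans (s≤s (m≤n+m _ d)) (≤-trans (≤-reflexive eq) (≤-pred (toℕ<n b)))

      a⁺ : Node path
      a⁺ = fsuc (fromℕ< a<S)

      toℕ-a⁺ : toℕ a⁺ ≡ suc (toℕ a)
      toℕ-a⁺ = cong suc (toℕ-fromℕ< a<S)

      a~a⁺ : TAdj path a a⁺
      a~a⁺ = inj₂ (fromℕ< a<S , refl , toℕ-injective (sym (trans (toℕ-inject₁ _) (toℕ-fromℕ< a<S))))

      eq⁺ : d + toℕ a⁺ ≡ toℕ b
      eq⁺ = trans (cong (d +_) toℕ-a⁺) (trans (+-suc d _) eq)

      a⁺⋯b : Interval _ a⁺ b
      a⁺⋯b t a⁺≤t = a⋯b t (≤-trans (n≤1+n _) (≤-trans (≤-reflexive (sym toℕ-a⁺)) a⁺≤t))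

  interval-connected : ∀ {P} → (∀ {a b} → P a → P b → Interval P a b) → ConnectedIn path P
  interval-connected convex a b pa pb with ≤-total (toℕ a) (toℕ b)
  ... | inj₁ a≤b = walk-up (toℕ b ∸ toℕ a) (m∸n+n≡m a≤b) (convex pa pb)
  ... | inj₂ b≤a = reverse (walk-up (toℕ a ∸ toℕ b) (m∸n+n≡m b≤a) (convex pb pa))

module VertexOrdering {n} (G : Graph n) (G? : ∀ u v → Dec (G u v))
  (G-sym : ∀ {u v} → G u v → G v u) (key : Fin n → ℕ) where

  open PathTree (maxOver key)

  Active : ℕ → Fin n → Set
  Active t v = key v ≤ t × ∃[ w ] (w ≡ v ⊎ G v w) × t ≤ key w

  active? : ∀ t v → Dec (Active t v)
  active? t v = key v ≤? t ×-dec any? λ w → (w ≟ᶠ v ⊎-dec G? v w) ×-dec t ≤? key w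

  activeBag : Node path → Subset n
  activeBag x = fromDec (active? (toℕ x))

  home : Fin n → Node path
  home v = fromℕ< (s≤s (≤maxOver key v))

  ∈activeBag-home : ∀ {u} v → Active (key v) u → u ∈ activeBag (home v)
  ∈activeBag-home v act =
    ∈fromDec⁺ (active? _) (subst (λ t → Active t _) (sym (toℕ-fromℕ< (s≤s (≤maxOver key v)))) act)

  decomposition : TreeDecomposition G
  decomposition = record
    { tree            = path
    ; bag             = activeBag
    ; covers-vertices = λ v → home v , ∈activeBag-home v (≤-refl , v , inj₁ refl , ≤-refl)
    ; covers-edges    = edges-covered
    ; connected       = λ v → interval-connected (convex v)
    }
    where
      edges-covered : ∀ u v → G u v → Σ (Node path) λ x → u ∈ activeBag x × v ∈ activeBag x
      edges-covered u v uv with ≤-total (key u) (key v)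
      ... | inj₁ u≤v = home v , ∈activeBag-home v (u≤v , v , inj₂ uv , ≤-refl)
                              , ∈activeBag-home v (≤-refl , v , inj₁ refl , ≤-refl)
      ... | inj₂ v≤u = home u , ∈activeBag-home u (≤-refl , u , inj₁ refl , ≤-refl)
                              , ∈activeBag-home u (v≤u , u , inj₂ (G-sym uv) , ≤-refl)

      convex : ∀ v {a b} → v ∈ activeBag a → v ∈ activeBag b → Interval (λ x → v ∈ activeBag x) a b
      convex v v∈a v∈b t a≤t t≤b with ∈fromDec⁻ (active? _) v∈a | ∈fromDec⁻ (active? _) v∈b
      ... | v≤a , _ | _ , w , near , b≤w =
        ∈fromDec⁺ (active? _) (≤-trans v≤a a≤t , w , near , ≤-trans t≤b b≤w)

  width≤ : ∀ {w} (candidates : ℕ → List (Fin n)) → (∀ t → length (candidates t) ≤ suc w) →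
           (∀ {t v} → Active t v → v ∈ᴸ candidates t) → WidthAtMost decomposition w
  width≤ {w} candidates short complete x = begin
    ∣ activeBag x ∣                    ≤⟨ p⊆q⇒∣p∣≤∣q∣ (∈fromList _ ∘ complete ∘ ∈fromDec⁻ (active? _)) ⟩
    ∣ fromList (candidates (toℕ x)) ∣  ≤⟨ ∣fromList∣≤length (candidates (toℕ x)) ⟩
    length (candidates (toℕ x))        ≤⟨ short (toℕ x) ⟩
    suc w                              ∎
    where open ≤-Reasoning

module MergedOrder {n} (m : ℕ) (blk : Fin n → ℕ) (blk-range : ∀ x → 1 ≤ blk x × blk x ≤ m)
  (μ : ℕ → Fin n → ℕ) (μ≤n : ∀ k x → μ k x ≤ n) (μ-injective : ∀ k {x y} → μ k x ≡ μ k y → x ≡ y)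
  (μ-within : ∀ k {x y} → blk x ≡ suc k → blk y ≡ suc k → μ (suc k) x < μ (suc k) y → μ k x < μ k y)
  where

  blk≢0 : ∀ {x} → blk x ≢ 0
  blk≢0 {x} b≡0 = <-irrefl (sym b≡0) (proj₁ (blk-range x))

  base : ℕ
  base = 2 + n

  Candidate : ℕ → Fin n → Fin n → Set
  Candidate k x p = blk p ≡ k × μ k p < μ k x

  candidate? : ∀ k x p → Dec (Candidate k x p)
  candidate? k x p = blk p ≟ k ×-dec μ k p <? μ k x

  -- For x in B_(k+1), code (k+1) x extends the largest code of an element of B_k below x along
  -- μ k by the digit 1 + μ (k+1) x < base; key pads all codes to m digits.
  mutual
    code : ℕ → Fin n → ℕ
    code zero    x = 0
    code (suc k) x = prefix k x * base + suc (μ (suc k) x)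

    prefix : ℕ → Fin n → ℕ
    prefix k x = maxOver (candidateCode k x)

    candidateCode : ℕ → Fin n → Fin n → ℕ
    candidateCode k x p with candidate? k x p
    ... | yes _ = code k p
    ... | no _  = 0

  code-pos : ∀ k x → 0 < code (suc k) x
  code-pos k x = <-≤-trans (s≤s z≤n) (m≤n+m _ _)

  digit<base : ∀ k x → suc (μ k x) < base
  digit<base k x = s≤s (s≤s (μ≤n k x))

  code≤prefix : ∀ {k x p} → Candidate k x p → code k p ≤ prefix k x
  code≤prefix {k} {x} {p} c = subst (_≤ prefix k x) candidateCode-yes (≤maxOver (candidateCode k x) p)
    where
      candidateCode-yes : candidateCode k x p ≡ code k p
      candidateCode-yes with candidate? k x p
      ... | yes _ = refl
      ... | no ¬c = ⊥-elim (¬c c)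

  prefix-mono : ∀ {k x y} → (∀ {p} → Candidate k x p → Candidate k y p) → prefix k x ≤ prefix k y
  prefix-mono {k} {x} {y} widen = maxOver-mono pointwise
    where
      pointwise : ∀ p → candidateCode k x p ≤ candidateCode k y p
      pointwise p with candidate? k x p | candidate? k y p
      ... | yes _  | yes _  = ≤-refl
      ... | yes cx | no ¬cy = ⊥-elim (¬cy (widen cx))
      ... | no _   | _      = z≤n

  prefix< : ∀ {k x v} → 0 < v → (∀ {p} → Candidate k x p → code k p < v) → prefix k x < v
  prefix< {k} {x} 0<v below = maxOver< 0<v pointwise
    where
      pointwise : ∀ p → candidateCode k x p < _
      pointwise p with candidate? k x p
      ... | yes c = below c
      ... | no _  = 0<v

  code-mono : ∀ k {x y} → blk x ≡ k → blk y ≡ k → μ k x < μ k y → code k x < code k y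
  code-mono zero    bx _ _ = ⊥-elim (blk≢0 bx)
  code-mono (suc k) bx by x<y = digits< base (prefix-mono widen) (s≤s x<y)
    where
      widen : ∀ {p} → Candidate k _ p → Candidate k _ p
      widen (bp , p<x) = bp , <-trans p<x (μ-within k bx by x<y)

  code-merge< : ∀ k {x y} → blk x ≡ k → μ k x < μ k y → code k x * base < code (suc k) y
  code-merge< k bx x<y = ≤-<-trans (*-monoˡ-≤ base (code≤prefix (bx , x<y))) (m<m+n _ (s≤s z≤n))

  code-merge> : ∀ k {x y} → blk x ≡ k → μ k y < μ k x → code (suc k) y < code k x * base
  code-merge> zero    bx _   = ⊥-elim (blk≢0 bx)
  code-merge> (suc k) {x} {y} bx y<x =
    carry< base (prefix< (code-pos k x) (λ (bp , p<y) → code-mono (suc k) bp bx (<-trans p<y y<x)))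
                (digit<base (suc (suc k)) y)

  key : Fin n → ℕ
  key x = code (blk x) x * base ^ (m ∸ blk x)

  InBlocks : ℕ → Fin n → Set
  InBlocks k x = blk x ≡ k ⊎ blk x ≡ suc k

  key-at : ∀ {k x} → blk x ≡ k → key x ≡ code k x * base ^ (m ∸ k)
  key-at {x = x} bx = cong (λ j → code j x * base ^ (m ∸ j)) bx

  key-at-below : ∀ {k x} → blk x ≡ k → k < m → key x ≡ code k x * base * base ^ (m ∸ suc k)
  key-at-below {k} {x} bx k<m = trans (key-at bx)
    (trans (cong (λ e → code k x * base ^ e) (+-∸-assoc 1 k<m)) (sym (*-assoc (code k x) base _)))

  scale< : ∀ e {a b} → a < b → a * base ^ e < b * base ^ e
  scale< e = *-monoˡ-< (base ^ e) {{m^n≢0 base e}}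

  code<⇒key< : ∀ {j x y} → blk x ≡ j → blk y ≡ j → code j x < code j y → key x < key y
  code<⇒key< {j} bx by x<y = subst₂ _<_ (sym (key-at bx)) (sym (key-at by)) (scale< (m ∸ j) x<y)

  below-top : ∀ {k x} → blk x ≡ suc k → k < m
  below-top {x = x} bx = subst (_≤ m) bx (proj₂ (blk-range x))

  key-mono : ∀ k {x y} → InBlocks k x → InBlocks k y → μ k x < μ k y → key x < key y
  key-mono k (inj₁ bx) (inj₁ by) x<y = code<⇒key< bx by (code-mono k bx by x<y)
  key-mono k (inj₂ bx) (inj₂ by) x<y = code<⇒key< bx by (code-mono (suc k) bx by
    (reflect-< (μ (suc k)) (μ-injective (suc k)) (μ k) (μ-within k by bx) x<y))
  key-mono k (inj₁ bx) (inj₂ by) x<y =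
    subst₂ _<_ (sym (key-at-below bx (below-top by))) (sym (key-at by))
      (scale< (m ∸ suc k) (code-merge< k bx x<y))
  key-mono k (inj₂ bx) (inj₁ by) x<y =
    subst₂ _<_ (sym (key-at bx)) (sym (key-at-below by (below-top bx)))
      (scale< (m ∸ suc k) (code-merge> k by x<y))

module Spiral {n} (π : Permutation′ n) (m : ℕ) (SD : SpiralDecomposition π m) where

  open SpiralDecomposition SD

  pos≤n : ∀ x → pos x ≤ n
  pos≤n x = <⇒≤ (toℕ<n x)

  val≤n : ∀ x → val x ≤ n
  val≤n x = <⇒≤ (toℕ<n (π ⟨$⟩ʳ x))

  pos-injective : ∀ {x y} → pos x ≡ pos y → x ≡ y
  pos-injective = toℕ-injective

  val-injective : ∀ {x y} → val x ≡ val y → x ≡ y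
  val-injective {x} {y} eq =
    trans (sym (inverseˡ π)) (trans (cong (π ⟨$⟩ˡ_) (toℕ-injective eq)) (inverseˡ π))

  val-inverse : ∀ a → val (π ⟨$⟩ˡ a) ≡ toℕ a
  val-inverse a = cong toℕ (inverseʳ π)

  even-inc⁻ : ∀ {x y} → blk x ≡ blk y → blk x % 2 ≡ 0 → val x < val y → pos x < pos y
  even-inc⁻ {x} {y} bx≡by even =
    reflect-< pos pos-injective val (even-inc y x (sym bx≡by) (trans (cong (_% 2) (sym bx≡by)) even))

  -- The coordinate in which B_k lies below B_(k-1): it turns by a quarter from block to block,
  -- and n ∸_ encodes the reversed orientations.
  axis : ℕ → Fin n → ℕ
  axis 0 x = n ∸ val x
  axis 1 x = pos x
  axis 2 x = val x
  axis 3 x = n ∸ pos x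
  axis (suc (suc (suc (suc k)))) x = axis k x

  axis≤n : ∀ k x → axis k x ≤ n
  axis≤n 0 x = m∸n≤m n (val x)
  axis≤n 1 x = pos≤n x
  axis≤n 2 x = val≤n x
  axis≤n 3 x = m∸n≤m n (pos x)
  axis≤n (suc (suc (suc (suc k)))) x = axis≤n k x

  axis-injective : ∀ k {x y} → axis k x ≡ axis k y → x ≡ y
  axis-injective 0 eq = val-injective (∸-cancelˡ-≡ (val≤n _) (val≤n _) eq)
  axis-injective 1 eq = pos-injective eq
  axis-injective 2 eq = val-injective eq
  axis-injective 3 eq = pos-injective (∸-cancelˡ-≡ (pos≤n _) (pos≤n _) eq)
  axis-injective (suc (suc (suc (suc k)))) eq = axis-injective k eq

  axis-2+ : ∀ k x → axis (2 + k) x ≡ n ∸ axis k x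
  axis-2+ 0 x = sym (m∸[m∸n]≡n (val≤n x))
  axis-2+ 1 x = refl
  axis-2+ 2 x = refl
  axis-2+ 3 x = sym (m∸[m∸n]≡n (pos≤n x))
  axis-2+ (suc (suc (suc (suc k)))) x = axis-2+ k x

  BlockRel⇒axis< : ∀ k {x y} → BlockRel (k % 4) (pos x) (val x) (pos y) (val y) → axis k x < axis k y
  BlockRel⇒axis< 0 {x} y<x = ∸-monoʳ-< y<x (val≤n x)
  BlockRel⇒axis< 1 x<y = x<y
  BlockRel⇒axis< 2 x<y = x<y
  BlockRel⇒axis< 3 {x} y<x = ∸-monoʳ-< y<x (pos≤n x)
  BlockRel⇒axis< (suc (suc (suc (suc k)))) rel = BlockRel⇒axis< k rel

  RestRel⇒axis< : ∀ k {x y} → RestRel (k % 4) (pos x) (val x) (pos y) (val y) →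
                  axis k x < axis k y × axis (suc k) x < axis (suc k) y
  RestRel⇒axis< 0 {x} (vy<vx , px<py) = ∸-monoʳ-< vy<vx (val≤n x) , px<py
  RestRel⇒axis< 1 (vx<vy , px<py) = px<py , vx<vy
  RestRel⇒axis< 2 {x} (vx<vy , py<px) = vx<vy , ∸-monoʳ-< py<px (pos≤n x)
  RestRel⇒axis< 3 {x} (vy<vx , py<px) = ∸-monoʳ-< py<px (pos≤n x) , ∸-monoʳ-< vy<vx (val≤n x)
  RestRel⇒axis< (suc (suc (suc (suc k)))) rel = RestRel⇒axis< k rel

  axis-within-block : ∀ k {x y} → blk x ≡ blk y → blk x % 2 ≡ suc k % 2 →
                      axis (suc k) x < axis (suc k) y → axis k x < axis k y
  axis-within-block 0 {x} {y} bx≡by odd x<y = ∸-monoʳ-< (odd-dec x y bx≡by odd x<y) (val≤n x)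
  axis-within-block 1 bx≡by even x<y = even-inc⁻ bx≡by even x<y
  axis-within-block 2 {x} {y} bx≡by odd x<y =
    odd-dec y x (sym bx≡by) (trans (cong (_% 2) (sym bx≡by)) odd) (∸-cancelʳ-< x<y)
  axis-within-block 3 {x} {y} bx≡by even x<y =
    ∸-monoʳ-< (even-inc⁻ (sym bx≡by) (trans (cong (_% 2) (sym bx≡by)) even) (∸-cancelʳ-< x<y))
              (pos≤n x)
  axis-within-block (suc (suc (suc (suc k)))) bx≡by parity x<y = axis-within-block k bx≡by parity x<y

  open MergedOrder m blk blk-range axis axis≤n axis-injective
    (λ k bx by → axis-within-block k (trans bx (sym by)) (cong (_% 2) bx))

  blk-index : ∀ x → ∃[ i ] blk x ≡ suc i × i < m
  blk-index x with blk x | blk-range x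
  ... | suc i | _ , i<m = i , refl , i<m

  BetweenBy : (Fin n → ℕ) → Fin n → Fin n → Fin n → Set
  BetweenBy f a w b = Between (f a) (f w) (f b)

  Splits : (Fin n → ℕ) → Set
  Splits c = ∀ k {a w b} → BetweenBy c a w b →
             BetweenBy (axis k) a w b ⊎ BetweenBy (axis (suc k)) a w b

  between-axis-2+ : ∀ k {a w b} → Between (axis k a) (axis k w) (axis k b) →
                    Between (axis (2 + k) a) (axis (2 + k) w) (axis (2 + k) b)
  between-axis-2+ k {a} {w} {b} a⋯b rewrite axis-2+ k a | axis-2+ k w | axis-2+ k b =
    between-reverse (axis≤n k a) (axis≤n k w) (axis≤n k b) a⋯b

  -- axis (k+2) is axis k reversed, and reversal preserves betweenness.
  splits : ∀ {c} → (∀ {a w b} → BetweenBy c a w b → BetweenBy (axis 0) a w b ⊎ BetweenBy (axis 1) a w b) →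
           Splits c
  splits split₀ zero    a⋯b = split₀ a⋯b
  splits split₀ (suc k) a⋯b = [ inj₂ ∘ between-axis-2+ k , inj₁ ]′ (splits split₀ k a⋯b)

  pos-splits : Splits pos
  pos-splits = splits inj₂

  val-splits : Splits val
  val-splits = splits λ {a} {w} {b} → inj₁ ∘ between-reverse (val≤n a) (val≤n w) (val≤n b)

  axis-next-block : ∀ {i x y} → blk x ≡ suc i → blk y ≡ i → axis (suc i) x < axis (suc i) y
  axis-next-block {i} {x} {y} bx by =
    subst (λ j → axis j x < axis j y) bx
      (BlockRel⇒axis< (blk x) (block-cond x y (trans bx (cong suc (sym by)))))

  axis-far-block : ∀ {i x y} → suc i < blk x → blk y ≡ i →
                   axis (suc i) x < axis (suc i) y × axis (2 + i) x < axis (2 + i) y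
  axis-far-block {i} {x} {y} far by =
    RestRel⇒axis< (suc i)
      (rest-cond x y (suc i) (cong suc by) far (≤-trans (<⇒≤ far) (proj₂ (blk-range x))))

  key-between : ∀ k {a w b} → InBlocks k a → InBlocks k w → InBlocks k b →
                BetweenBy (axis k) a w b → key w < key a ⊎ key w < key b
  key-between k ia iw ib (inj₁ (_ , w<b)) = inj₂ (key-mono k iw ib w<b)
  key-between k ia iw ib (inj₂ (_ , w<a)) = inj₁ (key-mono k iw ia w<a)

  sandwich-same : ∀ {c} → Splits c → ∀ {i a w b} → blk a ≡ i → blk w ≡ i → blk b ≡ i →
                  BetweenBy c a w b → key w < key a ⊎ key w < key b
  sandwich-same split {zero}  ba _ _ _ = ⊥-elim (blk≢0 ba)
  sandwich-same split {suc k} ba bw bb a⋯b =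
    [ key-between k (inj₂ ba) (inj₂ bw) (inj₂ bb)
    , key-between (suc k) (inj₁ ba) (inj₁ bw) (inj₁ bb) ]′ (split k a⋯b)

  sandwich : ∀ {c} → Splits c → ∀ {i a w b} → blk a ≡ i → blk b ≡ i →
             BetweenBy c a w b → key w < key a ⊎ key w < key b
  sandwich split {i} {a} {w} {b} ba bb a⋯b with relative (blk w) i
  ... | same bw = sandwich-same split ba bw bb a⋯b
  ... | next bw =
    [ key-between i (inj₁ ba) (inj₂ bw) (inj₁ bb)
    , ⊥-elim ∘ below-both⇒¬Between (axis-next-block bw ba) (axis-next-block bw bb) ]′ (split i a⋯b)
  ... | later far = ⊥-elim
    ([ below-both⇒¬Between (proj₁ (axis-far-block far ba)) (proj₁ (axis-far-block far bb))
     , below-both⇒¬Between (proj₂ (axis-far-block far ba)) (proj₂ (axis-far-block far bb)) ]′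
       (split (suc i) a⋯b))
  ... | previous refl =
    [ key-between (blk w) (inj₂ ba) (inj₁ refl) (inj₂ bb)
    , ⊥-elim ∘ above-both⇒¬Between (axis-next-block ba refl) (axis-next-block bb refl) ]′
      (split (blk w) a⋯b)
  ... | earlier far = ⊥-elim
    ([ above-both⇒¬Between (proj₁ (axis-far-block far-a refl)) (proj₁ (axis-far-block far-b refl))
     , above-both⇒¬Between (proj₂ (axis-far-block far-a refl)) (proj₂ (axis-far-block far-b refl)) ]′
       (split (suc (blk w)) a⋯b))
    where
      far-a : suc (blk w) < blk a
      far-a = subst (suc (blk w) <_) (sym ba) far
      far-b : suc (blk w) < blk b
      far-b = subst (suc (blk w) <_) (sym bb) far

  Next Prev : (Fin n → ℕ) → Fin n → Fin n → Set
  Next c x y = c y ≡ suc (c x)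
  Prev c x y = c x ≡ suc (c y)

  Frontier : (Fin n → Fin n → Set) → ℕ → ℕ → Fin n → Set
  Frontier R t i x = blk x ≡ i × key x < t × ∃[ y ] R x y × t ≤ key y

  frontier? : ∀ {R} → (∀ x y → Dec (R x y)) → ∀ t i x → Dec (Frontier R t i x)
  frontier? R? t i x = blk x ≟ i ×-dec key x <? t ×-dec any? λ y → R? x y ×-dec t ≤? key y

  module Frontiers (c : Fin n → ℕ) (c-injective : ∀ {x y} → c x ≡ c y → x ≡ y) (c-splits : Splits c)
    where

    no-late-between : ∀ {t x x′ y} → blk x ≡ blk x′ → key x < t → key x′ < t →
                      c x ≤ c y → c y ≤ c x′ → ¬ t ≤ key y
    no-late-between {t} {x} {x′} {y} bx≡bx′ x<t x′<t x≤y y≤x′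
      with m≤n⇒m<n∨m≡n x≤y | m≤n⇒m<n∨m≡n y≤x′
    ... | inj₂ x≡y | _        = <⇒≱ (subst (λ z → key z < t) (c-injective x≡y) x<t)
    ... | _        | inj₂ y≡x′ = <⇒≱ (subst (λ z → key z < t) (sym (c-injective y≡x′)) x′<t)
    ... | inj₁ x<y | inj₁ y<x′ =
      <⇒≱ ([ (λ y<x → <-trans y<x x<t) , (λ y<x′ → <-trans y<x′ x′<t) ]′
             (sandwich c-splits refl (sym bx≡bx′) (inj₁ (x<y , y<x′))))

    next-unique : ∀ {t i} → AtMostOne (Frontier (Next c) t i)
    next-unique = atMostOne-by c c-injective
      λ { {x} {x′} (bx , x<t , y , y≡1+x , t≤y) (bx′ , x′<t , _) x<x′ →
          no-late-between (trans bx (sym bx′)) x<t x′<t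
            (≤-trans (n≤1+n _) (≤-reflexive (sym y≡1+x))) (subst (_≤ c x′) (sym y≡1+x) x<x′) t≤y }

    prev-unique : ∀ {t i} → AtMostOne (Frontier (Prev c) t i)
    prev-unique = atMostOne-by c c-injective
      λ { {x} {x′} (bx , x<t , _) (bx′ , x′<t , y , x′≡1+y , t≤y) x<x′ →
          no-late-between (trans bx (sym bx′)) x<t x′<t
            (≤-pred (subst (c x <_) x′≡1+y x<x′)) (≤-trans (n≤1+n _) (≤-reflexive (sym x′≡1+y))) t≤y }

  open Frontiers pos pos-injective pos-splits
    renaming (next-unique to next-pos-unique; prev-unique to prev-pos-unique)
  open Frontiers val val-injective val-splits
    renaming (next-unique to next-val-unique; prev-unique to prev-val-unique)

  data Role : Set where
    tie next-pos prev-pos next-val prev-val : Role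

  roles : List Role
  roles = tie ∷ next-pos ∷ prev-pos ∷ next-val ∷ prev-val ∷ []

  ∈-roles : ∀ r → r ∈ᴸ roles
  ∈-roles tie      = here refl
  ∈-roles next-pos = there (here refl)
  ∈-roles prev-pos = there (there (here refl))
  ∈-roles next-val = there (there (there (here refl)))
  ∈-roles prev-val = there (there (there (there (here refl))))

  Plays : Role → ℕ → ℕ → Fin n → Set
  Plays tie      t i x = blk x ≡ i × key x ≡ t
  Plays next-pos = Frontier (Next pos)
  Plays prev-pos = Frontier (Prev pos)
  Plays next-val = Frontier (Next val)
  Plays prev-val = Frontier (Prev val)

  plays? : ∀ r t i x → Dec (Plays r t i x)
  plays? tie      t i x = blk x ≟ i ×-dec key x ≟ t
  plays? next-pos = frontier? λ x y → pos y ≟ suc (pos x)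
  plays? prev-pos = frontier? λ x y → pos x ≟ suc (pos y)
  plays? next-val = frontier? λ x y → val y ≟ suc (val x)
  plays? prev-val = frontier? λ x y → val x ≟ suc (val y)

  plays-unique : ∀ r {t i} → AtMostOne (Plays r t i)
  plays-unique tie {t} {i} = atMostOne-by (axis i) (axis-injective i)
    λ (bx , x≡t) (bx′ , x′≡t) x<x′ →
      <-irrefl (trans x≡t (sym x′≡t)) (key-mono i (inj₁ bx) (inj₁ bx′) x<x′)
  plays-unique next-pos = next-pos-unique
  plays-unique prev-pos = prev-pos-unique
  plays-unique next-val = next-val-unique
  plays-unique prev-val = prev-val-unique

  absDiffOne? : ∀ a b → Dec (AbsDiffOne a b)
  absDiffOne? a b = a ≟ suc b ⊎-dec b ≟ suc a

  Gπ? : ∀ a b → Dec (Gπ π a b)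
  Gπ? a b = absDiffOne? (toℕ (π ⟨$⟩ˡ a)) (toℕ (π ⟨$⟩ˡ b)) ⊎-dec absDiffOne? (toℕ a) (toℕ b)

  open VertexOrdering (Gπ π) Gπ? (⊎-map swap swap) (key ∘ (π ⟨$⟩ˡ_)) public

  active⇒plays : ∀ {t a} → Active t a → Σ Role λ r → Plays r t (blk (π ⟨$⟩ˡ a)) (π ⟨$⟩ˡ a)
  active⇒plays {t} {a} (a≤t , w , near , t≤w) with m≤n⇒m<n∨m≡n a≤t
  ... | inj₂ a≡t = tie , refl , a≡t
  ... | inj₁ a<t = role near
    where
      role : w ≡ a ⊎ Gπ π a w → Σ Role λ r → Plays r t (blk (π ⟨$⟩ˡ a)) (π ⟨$⟩ˡ a)
      role (inj₁ refl)            = ⊥-elim (<⇒≱ a<t t≤w)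
      role (inj₂ (inj₁ (inj₁ e))) = prev-pos , refl , a<t , π ⟨$⟩ˡ w , e , t≤w
      role (inj₂ (inj₁ (inj₂ e))) = next-pos , refl , a<t , π ⟨$⟩ˡ w , e , t≤w
      role (inj₂ (inj₂ (inj₁ e))) = prev-val , refl , a<t , π ⟨$⟩ˡ w ,
        trans (val-inverse a) (trans e (cong suc (sym (val-inverse w)))) , t≤w
      role (inj₂ (inj₂ (inj₂ e))) = next-val , refl , a<t , π ⟨$⟩ˡ w ,
        trans (val-inverse w) (trans e (cong suc (sym (val-inverse a)))) , t≤w

  player : ℕ → ℕ → Role → List (Fin n)
  player t i r = witness (plays? r t i)

  blockCandidates : ℕ → ℕ → List (Fin n)
  blockCandidates t i = concatMap (player t i) roles

  candidates : ℕ → List (Fin n)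
  candidates t = map (π ⟨$⟩ʳ_) (concatMap (blockCandidates t ∘ suc) (upTo m))

  length-candidates : ∀ t → length (candidates t) ≤ suc (6 * m)
  length-candidates t = begin
    length (candidates t)        ≡⟨ length-map (π ⟨$⟩ʳ_) (concatMap blocks (upTo m)) ⟩
    length (concatMap blocks (upTo m))
                                 ≤⟨ length-concatMap≤ blocks per-block (upTo m) ⟩
    5 * length (upTo m)          ≡⟨ cong (5 *_) (length-upTo m) ⟩
    5 * m                        ≤⟨ *-monoˡ-≤ m (n≤1+n 5) ⟩
    6 * m                        <⟨ n<1+n _ ⟩
    suc (6 * m)                  ∎
    where
      open ≤-Reasoning
      blocks : ℕ → List (Fin n)
      blocks = blockCandidates t ∘ suc
      per-block : ∀ i → length (blocks i) ≤ 5
      per-block i = length-concatMap≤ (player t (suc i)) (λ r → length-witness≤1 (plays? r t (suc i))) roles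

  active⇒candidate : ∀ {t a} → Active t a → a ∈ᴸ candidates t
  active⇒candidate {t} {a} act with active⇒plays act | blk-index (π ⟨$⟩ˡ a)
  ... | r , plays | i , bx , i<m =
    subst (_∈ᴸ candidates t) (inverseʳ π)
      (∈-map⁺ (π ⟨$⟩ʳ_)
        (∈-concatMap⁺′ (blockCandidates t ∘ suc)
          (∈-concatMap⁺′ (player t (suc i)) ∈player (∈-roles r)) (∈-upTo⁺ i<m)))
    where
      ∈player : π ⟨$⟩ˡ a ∈ᴸ player t (suc i) r
      ∈player = ∈-witness (plays? r t (suc i)) (plays-unique r) (subst (λ j → Plays r t j _) bx plays)

lemma11 : ∀ {n} (π : Permutation′ n) (m : ℕ) →
    InC11 π → Avoids3142 π → SpiralDecomposition π m →
    TreewidthAtMost (Gπ π) (6 * m)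
lemma11 π m _ _ SD = decomposition , width≤ candidates length-candidates active⇒candidate
  where open Spiral π m SD
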